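{- Let $p$ and $q$ be primes with $p\mid q-1$, let $r\in\mathbb Z$ satisfy $r^p\equiv 1\pmod q$ and $r\not\equiv1\pmod q$, and let $G=\langle \alpha,\tau:\ \alpha^q=1,\ \tau^p=1,\ \alpha\tau=\tau\alpha^r\rangle$. Let $S$ be a sequence over $G\setminus\{1\}$ such that the set of distinct terms of $S$ generates $G$. Then $|\pi(S)|\geq \min\{p,\ |S|\}$.
   Context: A sequence over a group $G$ is a finite unordered list of elements of $G$ with repetition allowed; its length $|S|$ is its number of terms with multiplicity. For a sequence $S$, $\pi(S)\subseteq G$ denotes the set of all products $g_1g_2\cdots g_\ell$ obtained over all orderings $g_1,\dots,g_\ell$ of the terms of $S$. -}

module Defs where

open import Data.Nat using (ℕ; zero; suc; _+_; _*_; _^_; NonZero)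
open import Data.Nat.DivMod using (_mod_)
open import Data.Fin using (Fin; toℕ)
open import Data.Integer using (ℤ)
open import Data.Integer.DivMod using (_%ℕ_)
open import Data.Product using (_×_; _,_; Σ-syntax)
open import Data.List using (List; []; _∷_; foldr)
open import Data.List.Membership.Propositional using (_∈_)
open import Data.List.Relation.Binary.Permutation.Propositional using (_↭_)
open import Relation.Binary.PropositionalEquality using (_≡_)

-- The metacyclic group  G = ⟨ α, τ : α^q = 1, τ^p = 1, ατ = τα^r ⟩,
-- realised by its normal form: every element is uniquely τ^t α^a with
-- t ∈ ℤ/p, a ∈ ℤ/q.  The pair (t , a) stands for τ^t α^a.
-- From ατ = τα^r we get τ^{-s} α^a τ^s = α^{a r^s}, hence
--   (τ^t α^a)(τ^s α^b) = τ^{t+s} α^{a r^s + b}.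
module Metacyclic (p q : ℕ) .{{_ : NonZero p}} .{{_ : NonZero q}} (r : ℤ) where

  G : Set
  G = Fin p × Fin q

  rₙ : ℕ
  rₙ = r %ℕ q

  one : G
  one = (0 mod p , 0 mod q)

  _·_ : G → G → G
  (t , a) · (s , b) = ((toℕ t + toℕ s) mod p , (toℕ a * rₙ ^ toℕ s + toℕ b) mod q)

  α : G
  α = (0 mod p , 1 mod q)

  τ : G
  τ = (1 mod p , 0 mod q)

  prod : List G → G
  prod = foldr _·_ one

  π : List G → G → Set
  π S g = Σ[ T ∈ List G ] (T ↭ S × prod T ≡ g)

  data Generated (S : List G) : G → Set where
    gen-elem : ∀ {x} → x ∈ S → Generated S x
    gen-one  : Generated S one
    gen-mul  : ∀ {x y} → Generated S x → Generated S y → Generated S (x · y)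
    gen-inv  : ∀ {x y} → Generated S x → x · y ≡ one → Generated S y

-- Write g = τ^t α^a and let ρ ≡ r (mod q); ρ has order exactly p modulo q.  Products are built one
-- term at a time.  If A is a set of distinct products of D inside one coset τ^T⟨α⟩, then for a new
-- term x the set x·A, enlarged by a·x for some a ∈ A with a·x ∉ x·A, consists of products of x ∷ D.
-- No such a exists only if A is closed under a ↦ x⁻¹ a x.  If moreover some a₀ ∈ A does not commute
-- with x, the α-exponents along the orbit of a₀ follow an affine recurrence c ↦ ρ^s c + β whose
-- first p values are distinct, so |A| ≥ p already.  Such an a₀ exists as soon as |A| ≥ 2, x ≠ 1 and
-- x ∉ ⟨α⟩ or T ≢ 0: two elements of a coset commuting with x force x ∈ ⟨α⟩ and, unless x = 1, the
-- coset to be ⟨α⟩.  Starting from a non-commuting pair z ∉ ⟨α⟩, w (taking w ∈ ⟨α⟩ when S has such a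
-- term) and adding the terms in ⟨α⟩ before the others keeps every step admissible.

{-# OPTIONS --safe #-}
module Submission where

open import Defs
open import Data.Nat using (ℕ; _∸_; _≤_; _⊓_; NonZero)
open import Data.Nat.Divisibility using (_∣_)
open import Data.Nat.Primality using (Prime)
open import Data.Integer using (ℤ; +_; _-_; 1ℤ) renaming (_^_ to _^ℤ_)
open import Data.Integer.Divisibility using () renaming (_∣_ to _∣ℤ_)
open import Data.Product using (_×_; Σ-syntax)
open import Data.List using (List; length)
open import Data.List.Relation.Unary.All using (All)
open import Data.List.Relation.Unary.Unique.Propositional using (Unique)
open import Relation.Binary.PropositionalEquality using (_≢_)
open import Relation.Nullary using (¬_)

open import Level using (0ℓ)
open import Function using (_∘_)
open import Data.Nat as ℕ using (zero; suc; _<_; z≤n; s≤s; _%_; _/_)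
import Data.Nat.Properties as ℕP
import Data.Nat.Divisibility as ℕD
open import Data.Nat.DivMod using (_mod_; m≡m%n+[m/n]*n; m%n<n; m<n⇒m%n≡m)
open import Data.Nat.Primality using (euclidsLemma; prime⇒nonTrivial)
open import Data.Nat.Coprimality using (prime⇒coprime; coprime-Bézout)
open import Data.Nat.GCD using (module Bézout)
open import Data.Integer using (_+_; _*_; -_; 0ℤ; ∣_∣)
import Data.Integer.Properties as ℤP
open import Data.Integer.DivMod using (_%ℕ_; _/ℕ_; a≡a%ℕn+[a/ℕn]*n)
open import Data.Integer.Divisibility.Signed
  using (divides; ∣m∣n⇒∣m+n; ∣m⇒∣-m; ∣m⇒∣m*n; ∣n⇒∣m*n; ∣⇒∣ᵤ; ∣ᵤ⇒∣) renaming (_∣_ to _∣ₛ_)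
open import Data.Integer.Tactic.RingSolver using (solve-∀)
open import Data.Fin using (toℕ)
import Data.Fin.Properties as FP
open import Data.Product using (_,_; proj₁; proj₂)
open import Data.Product.Properties using (≡-dec)
open import Data.Sum using (_⊎_; inj₁; inj₂; [_,_]′)
import Data.Sum as Sum
open import Data.List using ([]; _∷_; _++_; _∷ʳ_; [_]; map; lookup; partition)
open import Data.Nat.ListAction using (sum)
import Data.List.Properties as LP
open import Data.List.Membership.Propositional using (_∈_; find)
open import Data.List.Membership.Propositional.Properties using (∈-map⁻; ∈-∃++)
open import Data.List.Relation.Unary.All using ([]; _∷_; all?)
import Data.List.Relation.Unary.All as All
import Data.List.Relation.Unary.All.Properties as AllP
open import Data.List.Relation.Unary.Any using (Any; here; there; any?)
import Data.List.Relation.Unary.Any as Any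
open import Data.List.Relation.Unary.Any.Properties using (lookup-index)
open import Data.List.Relation.Unary.AllPairs using ([]; _∷_)
import Data.List.Relation.Unary.Unique.Propositional.Properties as UniqueP
open import Data.List.Relation.Binary.Permutation.Propositional
  using (_↭_; prep; ↭-refl; ↭-sym; ↭-trans; ↭ₛ⇒↭; module PermutationReasoning)
import Data.List.Relation.Binary.Permutation.Propositional.Properties as PermP
import Data.List.Relation.Binary.Permutation.Setoid.Properties as SetoidPermP
open import Relation.Binary using (Setoid; DecidableEquality)
open import Relation.Binary.PropositionalEquality
  using (_≡_; refl; sym; trans; cong; cong₂; subst; module ≡-Reasoning)
import Relation.Binary.PropositionalEquality as ≡
import Relation.Binary.Reasoning.Setoid as SetoidReasoning
open import Relation.Nullary using (Dec; yes; no; contradiction)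

∣∧<⇒≡0 : ∀ {m n} → m ℕD.∣ n → n < m → n ≡ 0
∣∧<⇒≡0 {n = zero}  _   _   = refl
∣∧<⇒≡0 {n = suc _} m∣n n<m = contradiction (ℕD.∣⇒≤ m∣n) (ℕP.<⇒≱ n<m)

⊓-suc-≤ : ∀ m n → m ⊓ suc n ≤ suc (m ⊓ n)
⊓-suc-≤ zero    n = z≤n
⊓-suc-≤ (suc m) n = s≤s (ℕP.⊓-monoˡ-≤ n (ℕP.n≤1+n m))

∣[n∸1]⇒< : ∀ {m n} → 1 < n → m ℕD.∣ n ∸ 1 → m < n
∣[n∸1]⇒< {n = suc zero}    (s≤s ()) _
∣[n∸1]⇒< {n = suc (suc n)} _ m∣n+1 = s≤s (ℕD.∣⇒≤ m∣n+1)

toℕ-mod : ∀ (n : ℕ) {k : ℕ} .{{_ : NonZero k}} → toℕ (n mod k) ≡ n % k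
toℕ-mod n = FP.toℕ-fromℕ< _

pos-^ : ∀ a n → + (a ℕ.^ n) ≡ (+ a) ^ℤ n
pos-^ a zero    = refl
pos-^ a (suc n) = trans (ℤP.pos-* a (a ℕ.^ n)) (cong (_*_ (+ a)) (pos-^ a n))

module _ {A : Set} where

  ∈⇒↭∷ : ∀ {x : A} {xs} → x ∈ xs → Σ[ ys ∈ List A ] (xs ↭ x ∷ ys)
  ∈⇒↭∷ {x} x∈xs with ys , zs , refl ← ∈-∃++ x∈xs = ys ++ zs , PermP.shift x ys zs

  ∈-∈-≢⇒↭∷∷ : ∀ {x y : A} {xs} → x ∈ xs → y ∈ xs → x ≢ y → Σ[ zs ∈ List A ] (xs ↭ x ∷ y ∷ zs)
  ∈-∈-≢⇒↭∷∷ x∈xs y∈xs x≢y with ys , xs↭x∷ys ← ∈⇒↭∷ x∈xs | PermP.∈-resp-↭ xs↭x∷ys y∈xs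
  ... | here y≡x   = contradiction (sym y≡x) x≢y
  ... | there y∈ys = let zs , ys↭y∷zs = ∈⇒↭∷ y∈ys in zs , ↭-trans xs↭x∷ys (prep _ ys↭y∷zs)

  All-↭∷∷ : ∀ {P : A → Set} {x y xs zs} → xs ↭ x ∷ y ∷ zs → All P xs → All P zs
  All-↭∷∷ xs↭x∷y∷zs Pxs with _ ∷ _ ∷ Pzs ← PermP.All-resp-↭ xs↭x∷y∷zs Pxs = Pzs

  distinct-values⇒≤length : ∀ n (xs : List A) (f : ℕ → A) → (∀ k → f k ∈ xs) →
                            (∀ {i j} → i < j → j < n → f i ≢ f j) → n ≤ length xs
  distinct-values⇒≤length n xs f f∈xs f-distinct with n ℕ.≤? length xs
  ... | yes n≤∣xs∣ = n≤∣xs∣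
  ... | no  n≰∣xs∣
    with i , j , i<j , same-position ← FP.pigeonhole (ℕP.≰⇒> n≰∣xs∣) (Any.index ∘ f∈xs ∘ toℕ)
    = contradiction fᵢ≡fⱼ (f-distinct i<j (FP.toℕ<n j))
    where
    open ≡-Reasoning
    fᵢ≡fⱼ : f (toℕ i) ≡ f (toℕ j)
    fᵢ≡fⱼ = begin
      f (toℕ i)                              ≡⟨ lookup-index (f∈xs (toℕ i)) ⟩
      lookup xs (Any.index (f∈xs (toℕ i)))   ≡⟨ cong (lookup xs) same-position ⟩
      lookup xs (Any.index (f∈xs (toℕ j)))   ≡⟨ lookup-index (f∈xs (toℕ j)) ⟨
      f (toℕ j)                              ∎

geom : ℤ → ℕ → ℤ
geom u zero    = 0ℤ
geom u (suc j) = geom u j + u ^ℤ j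

geom-telescope : ∀ u j → (u - 1ℤ) * geom u j ≡ u ^ℤ j - 1ℤ
geom-telescope u zero    = trans (ℤP.*-zeroʳ (u - 1ℤ)) (sym (ℤP.+-inverseʳ 1ℤ))
geom-telescope u (suc j) = begin
  (u - 1ℤ) * (geom u j + u ^ℤ j)             ≡⟨ ℤP.*-distribˡ-+ (u - 1ℤ) (geom u j) (u ^ℤ j) ⟩
  (u - 1ℤ) * geom u j + (u - 1ℤ) * u ^ℤ j    ≡⟨ cong (_+ (u - 1ℤ) * u ^ℤ j) (geom-telescope u j) ⟩
  (u ^ℤ j - 1ℤ) + (u - 1ℤ) * u ^ℤ j          ≡⟨ step u (u ^ℤ j) ⟩
  u * u ^ℤ j - 1ℤ                            ∎
  where
  open ≡-Reasoning
  step : ∀ u w → (w - 1ℤ) + (u - 1ℤ) * w ≡ u * w - 1ℤ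
  step = solve-∀

geom-1 : ∀ j → geom 1ℤ j ≡ + j
geom-1 zero    = refl
geom-1 (suc j) = begin
  geom 1ℤ j + 1ℤ ^ℤ j   ≡⟨ cong₂ _+_ (geom-1 j) (ℤP.^-zeroˡ j) ⟩
  + (j ℕ.+ 1)           ≡⟨ cong +_ (ℕP.+-comm j 1) ⟩
  + suc j               ∎
  where open ≡-Reasoning

module Congruence (m : ℕ) where

  infix 4 _≈_
  -- A record rather than a definition, so that x and y can be inferred from a proof of x ≈ y.
  record _≈_ (x y : ℤ) : Set where
    constructor mk≈
    field ≈⇒∣ : + m ∣ₛ x - y
  open _≈_ public

  private variable x y z u v β x′ y′ : ℤ

  ≈-by-multiple : ∀ k → x ≡ y + k * + m → x ≈ y
  ≈-by-multiple {y = y} k refl = mk≈ (divides k (cancel y k (+ m)))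
    where
    cancel : ∀ y k m → (y + k * m) - y ≡ k * m
    cancel = solve-∀

  ≈-reflexive : x ≡ y → x ≈ y
  ≈-reflexive {x} refl = ≈-by-multiple 0ℤ (sym (ℤP.+-identityʳ x))

  ≈-refl : x ≈ x
  ≈-refl = ≈-reflexive refl

  ≈-resp-difference : x ≈ y → x - y ≡ u - v → u ≈ v
  ≈-resp-difference (mk≈ m∣x-y) eq = mk≈ (subst (+ m ∣ₛ_) eq m∣x-y)

  ≈-sym : x ≈ y → y ≈ x
  ≈-sym {x} {y} (mk≈ m∣x-y) = mk≈ (subst (+ m ∣ₛ_) (negate x y) (∣m⇒∣-m m∣x-y))
    where
    negate : ∀ x y → - (x - y) ≡ y - x
    negate = solve-∀

  ≈-trans : x ≈ y → y ≈ z → x ≈ z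
  ≈-trans {x} {y} {z} (mk≈ m∣x-y) (mk≈ m∣y-z) =
    mk≈ (subst (+ m ∣ₛ_) (telescope x y z) (∣m∣n⇒∣m+n m∣x-y m∣y-z))
    where
    telescope : ∀ x y z → (x - y) + (y - z) ≡ x - z
    telescope = solve-∀

  ≈-setoid : Setoid 0ℓ 0ℓ
  ≈-setoid = record
    { Carrier = ℤ ; _≈_ = _≈_ ; isEquivalence = record { refl = ≈-refl ; sym = ≈-sym ; trans = ≈-trans } }

  module ≈-Reasoning = SetoidReasoning ≈-setoid

  +-cong : x ≈ x′ → y ≈ y′ → x + y ≈ x′ + y′
  +-cong {x} {x′} {y} {y′} (mk≈ d) (mk≈ e) = mk≈ (subst (+ m ∣ₛ_) (regroup x x′ y y′) (∣m∣n⇒∣m+n d e))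
    where
    regroup : ∀ x x′ y y′ → (x - x′) + (y - y′) ≡ (x + y) - (x′ + y′)
    regroup = solve-∀

  -‿cong : x ≈ y → - x ≈ - y
  -‿cong {x} {y} (mk≈ m∣x-y) = mk≈ (subst (+ m ∣ₛ_) (negate x y) (∣m⇒∣-m m∣x-y))
    where
    negate : ∀ x y → - (x - y) ≡ - x - - y
    negate = solve-∀

  +-congˡ : ∀ x → y ≈ y′ → x + y ≈ x + y′
  +-congˡ x = +-cong (≈-refl {x})

  +-congʳ : ∀ y → x ≈ x′ → x + y ≈ x′ + y
  +-congʳ y x≈x′ = +-cong x≈x′ (≈-refl {y})

  -cong : x ≈ x′ → y ≈ y′ → x - y ≈ x′ - y′
  -cong x≈x′ y≈y′ = +-cong x≈x′ (-‿cong y≈y′)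

  *-cong : x ≈ x′ → y ≈ y′ → x * y ≈ x′ * y′
  *-cong {x} {x′} {y} {y′} (mk≈ d) (mk≈ e) =
    mk≈ (subst (+ m ∣ₛ_) (expand x x′ y y′) (∣m∣n⇒∣m+n (∣m⇒∣m*n y d) (∣n⇒∣m*n x′ e)))
    where
    expand : ∀ x x′ y y′ → (x - x′) * y + x′ * (y - y′) ≡ x * y - x′ * y′
    expand = solve-∀

  *-congˡ : ∀ x → y ≈ y′ → x * y ≈ x * y′
  *-congˡ x = *-cong (≈-refl {x})

  *-congʳ : ∀ y → x ≈ x′ → x * y ≈ x′ * y
  *-congʳ y x≈x′ = *-cong x≈x′ (≈-refl {y})

  ^-congˡ : ∀ n → x ≈ y → x ^ℤ n ≈ y ^ℤ n
  ^-congˡ zero    _   = ≈-refl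
  ^-congˡ (suc n) x≈y = *-cong x≈y (^-congˡ n x≈y)

  ^≈1⇒^[k*n]≈1 : ∀ k n → x ^ℤ n ≈ 1ℤ → x ^ℤ (k ℕ.* n) ≈ 1ℤ
  ^≈1⇒^[k*n]≈1 {x} k n xⁿ≈1 = begin
    x ^ℤ (k ℕ.* n)    ≡⟨ cong (x ^ℤ_) (ℕP.*-comm k n) ⟩
    x ^ℤ (n ℕ.* k)    ≡⟨ ℤP.^-*-assoc x n k ⟨
    (x ^ℤ n) ^ℤ k     ≈⟨ ^-congˡ k xⁿ≈1 ⟩
    1ℤ ^ℤ k           ≡⟨ ℤP.^-zeroˡ k ⟩
    1ℤ                ∎
    where open ≈-Reasoning

  +-cancelˡ : ∀ x → x + y ≈ x + z → y ≈ z
  +-cancelˡ {y} {z} x x+y≈x+z = ≈-resp-difference x+y≈x+z (cancel x y z)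
    where
    cancel : ∀ x y z → (x + y) - (x + z) ≡ y - z
    cancel = solve-∀

  ≈0⇒∣ : x ≈ 0ℤ → + m ∣ₛ x
  ≈0⇒∣ {x} (mk≈ d) = subst (+ m ∣ₛ_) (ℤP.+-identityʳ x) d

  ∣⇒≈0 : + m ∣ₛ x → x ≈ 0ℤ
  ∣⇒≈0 {x} d = mk≈ (subst (+ m ∣ₛ_) (sym (ℤP.+-identityʳ x)) d)

  -≈0⇒≈ : x - y ≈ 0ℤ → x ≈ y
  -≈0⇒≈ = mk≈ ∘ ≈0⇒∣

  %-≈ : .{{_ : NonZero m}} → ∀ n → + (n % m) ≈ + n
  %-≈ n = ≈-sym (≈-by-multiple (+ (n / m)) (begin
    + n                            ≡⟨ cong +_ (m≡m%n+[m/n]*n n m) ⟩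
    + (n % m ℕ.+ n / m ℕ.* m)      ≡⟨ ℤP.pos-+ (n % m) (n / m ℕ.* m) ⟩
    + (n % m) + + (n / m ℕ.* m)    ≡⟨ cong (_+_ (+ (n % m))) (ℤP.pos-* (n / m) m) ⟩
    + (n % m) + + (n / m) * + m    ∎))
    where open ≡-Reasoning

  +≈+⇒≡ : ∀ {a b} → a < m → b < m → + a ≈ + b → a ≡ b
  +≈+⇒≡ {a} {b} a<m b<m (mk≈ m∣a-b) =
    ℤP.+-injective (ℤP.i-j≡0⇒i≡j (+ a) (+ b) (ℤP.∣i∣≡0⇒i≡0 distance≡0))
    where
    distance<m : ∣ + a - + b ∣ < m
    distance<m = subst (_< m) (cong ∣_∣ (sym (ℤP.m-n≡m⊖n a b)))
                   (ℕP.≤-<-trans (ℤP.∣m⊝n∣≤m⊔n a b) (ℕP.⊔-lub a<m b<m))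
    distance≡0 : ∣ + a - + b ∣ ≡ 0
    distance≡0 = ∣∧<⇒≡0 (∣⇒∣ᵤ m∣a-b) distance<m

  affine-orbit : ∀ (c : ℕ → ℤ) → (∀ k → c (suc k) ≈ u * c k + β) →
                 ∀ i j → c (i ℕ.+ j) - c i ≈ u ^ℤ i * geom u j * (c 1 - c 0)
  affine-orbit {u} {β} c step = orbit
    where
    open ≈-Reasoning
    Δ : ℕ → ℤ
    Δ k = c (suc k) - c k

    Δ-closed : ∀ k → Δ k ≈ u ^ℤ k * Δ 0
    Δ-closed zero    = ≈-reflexive (sym (ℤP.*-identityˡ (Δ 0)))
    Δ-closed (suc k) = begin
      c (suc (suc k)) - c (suc k)        ≈⟨ -cong (step (suc k)) (step k) ⟩
      (u * c (suc k) + β) - (u * c k + β) ≡⟨ factor u β (c (suc k)) (c k) ⟩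
      u * Δ k                            ≈⟨ *-congˡ u (Δ-closed k) ⟩
      u * (u ^ℤ k * Δ 0)                 ≡⟨ ℤP.*-assoc u (u ^ℤ k) (Δ 0) ⟨
      u * u ^ℤ k * Δ 0                   ∎
      where
      factor : ∀ u β a b → (u * a + β) - (u * b + β) ≡ u * (a - b)
      factor = solve-∀

    orbit : ∀ i j → c (i ℕ.+ j) - c i ≈ u ^ℤ i * geom u j * Δ 0
    orbit i zero    = begin
      c (i ℕ.+ 0) - c i          ≡⟨ cong (λ n → c n - c i) (ℕP.+-identityʳ i) ⟩
      c i - c i                  ≡⟨ ℤP.+-inverseʳ (c i) ⟩
      0ℤ                         ≡⟨ vanish (u ^ℤ i) (Δ 0) ⟩
      u ^ℤ i * 0ℤ * Δ 0          ∎
      where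
      vanish : ∀ a b → 0ℤ ≡ a * 0ℤ * b
      vanish = solve-∀
    orbit i (suc j) = begin
      c (i ℕ.+ suc j) - c i                              ≡⟨ cong (λ n → c n - c i) (ℕP.+-suc i j) ⟩
      c (suc (i ℕ.+ j)) - c i                            ≡⟨ split (c (suc (i ℕ.+ j))) (c (i ℕ.+ j)) (c i) ⟩
      Δ (i ℕ.+ j) + (c (i ℕ.+ j) - c i)                  ≈⟨ +-cong (Δ-closed (i ℕ.+ j)) (orbit i j) ⟩
      u ^ℤ (i ℕ.+ j) * Δ 0 + u ^ℤ i * geom u j * Δ 0     ≡⟨ cong (λ w → w * Δ 0 + u ^ℤ i * geom u j * Δ 0)
                                                              (ℤP.^-distribˡ-+-* u i j) ⟩
      u ^ℤ i * u ^ℤ j * Δ 0 + u ^ℤ i * geom u j * Δ 0    ≡⟨ collect (u ^ℤ i) (u ^ℤ j) (geom u j) (Δ 0) ⟩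
      u ^ℤ i * (geom u j + u ^ℤ j) * Δ 0                 ∎
      where
      split : ∀ a b c → a - c ≡ (a - b) + (b - c)
      split = solve-∀
      collect : ∀ a b g d → a * b * d + a * g * d ≡ a * (g + b) * d
      collect = solve-∀

  module _ (m-prime : Prime m) where

    *≈0⇒ : x * y ≈ 0ℤ → x ≈ 0ℤ ⊎ y ≈ 0ℤ
    *≈0⇒ {x} {y} xy≈0 = Sum.map (∣⇒≈0 ∘ ∣ᵤ⇒∣) (∣⇒≈0 ∘ ∣ᵤ⇒∣)
      (euclidsLemma ∣ x ∣ ∣ y ∣ m-prime (subst (m ℕD.∣_) (ℤP.abs-* x y) (∣⇒∣ᵤ (≈0⇒∣ xy≈0))))

    1≉0 : ¬ 1ℤ ≈ 0ℤ
    1≉0 1≈0 = ℕP.<⇒≢ (ℕ.nonTrivial⇒n>1 m {{prime⇒nonTrivial m-prime}})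
                     (sym (ℕD.∣1⇒≡1 (∣⇒∣ᵤ (≈0⇒∣ 1≈0))))

    ^≉0 : ¬ x ≈ 0ℤ → ∀ n → ¬ x ^ℤ n ≈ 0ℤ
    ^≉0 x≉0 zero    = 1≉0
    ^≉0 x≉0 (suc n) = [ x≉0 , ^≉0 x≉0 n ]′ ∘ *≈0⇒

module MetacyclicProperties
  (p q : ℕ) .{{p≢0 : NonZero p}} .{{q≢0 : NonZero q}} (r : ℤ)
  (p-prime : Prime p) (q-prime : Prime q) (p∣q-1 : p ∣ q ∸ 1)
  (q∣r^p-1 : + q ∣ℤ (r ^ℤ p) - 1ℤ) (q∤r-1 : ¬ (+ q ∣ℤ r - 1ℤ)) where

  open Metacyclic p q r
  open Congruence q
  module P = Congruence p

  1<p : 1 < p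
  1<p = ℕ.nonTrivial⇒n>1 p {{prime⇒nonTrivial p-prime}}

  p<q : p < q
  p<q = ∣[n∸1]⇒< (ℕ.nonTrivial⇒n>1 q {{prime⇒nonTrivial q-prime}}) p∣q-1

  <p⇒<q : ∀ {n} → n < p → n < q
  <p⇒<q n<p = ℕP.<-trans n<p p<q

  ρ : ℤ
  ρ = + rₙ

  r≈ρ : r ≈ ρ
  r≈ρ = ≈-by-multiple (r /ℕ q) (a≡a%ℕn+[a/ℕn]*n r q)

  ρ^p≈1 : ρ ^ℤ p ≈ 1ℤ
  ρ^p≈1 = ≈-trans (^-congˡ p (≈-sym r≈ρ)) (mk≈ (∣ᵤ⇒∣ q∣r^p-1))

  ρ≉1 : ¬ ρ ≈ 1ℤ
  ρ≉1 ρ≈1 = q∤r-1 (∣⇒∣ᵤ (≈⇒∣ (≈-trans r≈ρ ρ≈1)))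

  ρ≉0 : ¬ ρ ≈ 0ℤ
  ρ≉0 ρ≈0 = 1≉0 q-prime (begin
    1ℤ                     ≈⟨ ρ^p≈1 ⟨
    ρ ^ℤ p                 ≡⟨ cong (ρ ^ℤ_) (ℕP.suc-pred p) ⟨
    ρ * ρ ^ℤ ℕ.pred p      ≈⟨ *-congʳ (ρ ^ℤ ℕ.pred p) ρ≈0 ⟩
    0ℤ * ρ ^ℤ ℕ.pred p     ≡⟨ ℤP.*-zeroˡ (ρ ^ℤ ℕ.pred p) ⟩
    0ℤ                     ∎)
    where open ≈-Reasoning

  ρ^-%p : ∀ n → ρ ^ℤ (n % p) ≈ ρ ^ℤ n
  ρ^-%p n = begin
    ρ ^ℤ (n % p)                          ≡⟨ ℤP.*-identityʳ (ρ ^ℤ (n % p)) ⟨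
    ρ ^ℤ (n % p) * 1ℤ                     ≈⟨ *-congˡ (ρ ^ℤ (n % p)) (^≈1⇒^[k*n]≈1 (n / p) p ρ^p≈1) ⟨
    ρ ^ℤ (n % p) * ρ ^ℤ (n / p ℕ.* p)     ≡⟨ ℤP.^-distribˡ-+-* ρ (n % p) (n / p ℕ.* p) ⟨
    ρ ^ℤ (n % p ℕ.+ n / p ℕ.* p)          ≡⟨ cong (ρ ^ℤ_) (m≡m%n+[m/n]*n n p) ⟨
    ρ ^ℤ n                                ∎
    where open ≈-Reasoning

  ρ^-cong : ∀ {a b} → + a P.≈ + b → ρ ^ℤ a ≈ ρ ^ℤ b
  ρ^-cong {a} {b} a≈b = begin
    ρ ^ℤ a         ≈⟨ ρ^-%p a ⟨
    ρ ^ℤ (a % p)   ≡⟨ cong (ρ ^ℤ_) a%p≡b%p ⟩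
    ρ ^ℤ (b % p)   ≈⟨ ρ^-%p b ⟩
    ρ ^ℤ b         ∎
    where
    open ≈-Reasoning
    a%p≡b%p : a % p ≡ b % p
    a%p≡b%p = P.+≈+⇒≡ (m%n<n a p) (m%n<n b p) (P.≈-trans (P.%-≈ a) (P.≈-trans a≈b (P.≈-sym (P.%-≈ b))))

  consecutive-powers⇒ρ≈1 : ∀ {a b} → 1 ℕ.+ a ≡ b → ρ ^ℤ a ≈ 1ℤ → ρ ^ℤ b ≈ 1ℤ → ρ ≈ 1ℤ
  consecutive-powers⇒ρ≈1 {a} refl ρᵃ≈1 ρ¹⁺ᵃ≈1 = begin
    ρ               ≡⟨ ℤP.*-identityʳ ρ ⟨
    ρ * 1ℤ          ≈⟨ *-congˡ ρ ρᵃ≈1 ⟨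
    ρ * ρ ^ℤ a      ≈⟨ ρ¹⁺ᵃ≈1 ⟩
    1ℤ              ∎
    where open ≈-Reasoning

  bézout⇒ρ≈1 : ∀ {j} → Bézout.Identity 1 p j → ρ ^ℤ j ≈ 1ℤ → ρ ≈ 1ℤ
  bézout⇒ρ≈1 {j} (Bézout.+- x y 1+yj≡xp) ρʲ≈1 =
    consecutive-powers⇒ρ≈1 1+yj≡xp (^≈1⇒^[k*n]≈1 y j ρʲ≈1) (^≈1⇒^[k*n]≈1 x p ρ^p≈1)
  bézout⇒ρ≈1 {j} (Bézout.-+ x y 1+xp≡yj) ρʲ≈1 =
    consecutive-powers⇒ρ≈1 1+xp≡yj (^≈1⇒^[k*n]≈1 x p ρ^p≈1) (^≈1⇒^[k*n]≈1 y j ρʲ≈1)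

  ρ^≈1⇒p∣ : ∀ n → ρ ^ℤ n ≈ 1ℤ → p ∣ n
  ρ^≈1⇒p∣ n ρⁿ≈1 with n % p ℕ.≟ 0
  ... | yes n%p≡0 = ℕD.m%n≡0⇒n∣m n p n%p≡0
  ... | no  n%p≢0 = contradiction (bézout⇒ρ≈1 bézout (≈-trans (ρ^-%p n) ρⁿ≈1)) ρ≉1
    where bézout = coprime-Bézout (prime⇒coprime p-prime {{ℕ.≢-nonZero n%p≢0}} (m%n<n n p))

  ρ^≈1⇒≡0 : ∀ {n} → n < p → ρ ^ℤ n ≈ 1ℤ → n ≡ 0
  ρ^≈1⇒≡0 {n} n<p ρⁿ≈1 = ∣∧<⇒≡0 (ρ^≈1⇒p∣ n ρⁿ≈1) n<p

  geom-ρ^≉0 : ∀ {s j} → s < p → 0 < j → j < p → ¬ geom (ρ ^ℤ s) j ≈ 0ℤ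
  geom-ρ^≉0 {s} {j} s<p 0<j j<p geom≈0 with euclidsLemma s j p-prime (ρ^≈1⇒p∣ (s ℕ.* j) ρ^sj≈1)
    where
    ρ^sj≈1 : ρ ^ℤ (s ℕ.* j) ≈ 1ℤ
    ρ^sj≈1 = -≈0⇒≈ (begin
      ρ ^ℤ (s ℕ.* j) - 1ℤ                ≡⟨ cong (_- 1ℤ) (ℤP.^-*-assoc ρ s j) ⟨
      (ρ ^ℤ s) ^ℤ j - 1ℤ                 ≡⟨ geom-telescope (ρ ^ℤ s) j ⟨
      (ρ ^ℤ s - 1ℤ) * geom (ρ ^ℤ s) j    ≈⟨ *-congˡ (ρ ^ℤ s - 1ℤ) geom≈0 ⟩
      (ρ ^ℤ s - 1ℤ) * 0ℤ                 ≡⟨ ℤP.*-zeroʳ (ρ ^ℤ s - 1ℤ) ⟩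
      0ℤ                                 ∎)
      where open ≈-Reasoning
  ... | inj₂ p∣j = ℕP.<⇒≢ 0<j (sym (∣∧<⇒≡0 p∣j j<p))
  -- For s = 0 the sum is j itself, which is nonzero modulo q as j < p < q.
  ... | inj₁ p∣s with refl ← ∣∧<⇒≡0 p∣s s<p =
    ℕP.<⇒≢ 0<j (sym (+≈+⇒≡ (<p⇒<q j<p) (<p⇒<q (ℕP.<-trans 0<j j<p)) (subst (_≈ 0ℤ) (geom-1 j) geom≈0)))

  -- Exponents of the normal form and the group laws

  τ-exp : G → ℕ
  τ-exp g = toℕ (proj₁ g)

  α-exp : G → ℤ
  α-exp g = + toℕ (proj₂ g)

  twist : G → ℤ
  twist g = ρ ^ℤ τ-exp g

  τ-exp<p : ∀ g → τ-exp g < p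
  τ-exp<p g = FP.toℕ<n (proj₁ g)

  τ-exp-· : ∀ g h → + τ-exp (g · h) P.≈ + τ-exp g + + τ-exp h
  τ-exp-· g h = P.≈-trans (P.≈-reflexive (cong +_ (toℕ-mod _))) (P.%-≈ _)

  α-exp-· : ∀ g h → α-exp (g · h) ≈ α-exp g * twist h + α-exp h
  α-exp-· g h = begin
    α-exp (g · h)                         ≡⟨ cong +_ (toℕ-mod _) ⟩
    + ((a ℕ.* rₙ ℕ.^ s ℕ.+ b) % q)        ≈⟨ %-≈ _ ⟩
    + (a ℕ.* rₙ ℕ.^ s ℕ.+ b)              ≡⟨ ℤP.pos-+ (a ℕ.* rₙ ℕ.^ s) b ⟩
    + (a ℕ.* rₙ ℕ.^ s) + + b              ≡⟨ cong (_+ + b) (ℤP.pos-* a (rₙ ℕ.^ s)) ⟩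
    + a * + (rₙ ℕ.^ s) + + b              ≡⟨ cong (λ w → + a * w + + b) (pos-^ rₙ s) ⟩
    α-exp g * twist h + α-exp h           ∎
    where
    open ≈-Reasoning
    a = toℕ (proj₂ g)
    b = toℕ (proj₂ h)
    s = τ-exp h

  twist-· : ∀ g h → twist (g · h) ≈ twist g * twist h
  twist-· g h = ≈-trans (ρ^-cong (τ-exp-· g h)) (≈-reflexive (ℤP.^-distribˡ-+-* ρ (τ-exp g) (τ-exp h)))

  ≡-from-exps : ∀ {g h} → + τ-exp g P.≈ + τ-exp h → α-exp g ≈ α-exp h → g ≡ h
  ≡-from-exps {g} {h} τ≈ α≈ = cong₂ _,_
    (FP.toℕ-injective (P.+≈+⇒≡ (τ-exp<p g) (τ-exp<p h) τ≈))
    (FP.toℕ-injective (+≈+⇒≡ (FP.toℕ<n (proj₂ g)) (FP.toℕ<n (proj₂ h)) α≈))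

  τ-exp-one : τ-exp one ≡ 0
  τ-exp-one = trans (toℕ-mod 0) (m<n⇒m%n≡m (ℕ.>-nonZero⁻¹ p))

  α-exp-one : α-exp one ≡ 0ℤ
  α-exp-one = cong +_ (trans (toℕ-mod 0) (m<n⇒m%n≡m (ℕ.>-nonZero⁻¹ q)))

  τ-exp-α : τ-exp α ≡ 0
  τ-exp-α = τ-exp-one

  α-exp-α : α-exp α ≡ 1ℤ
  α-exp-α = cong +_ (trans (toℕ-mod 1) (m<n⇒m%n≡m (ℕ.nonTrivial⇒n>1 q {{prime⇒nonTrivial q-prime}})))

  τ-exp-τ : τ-exp τ ≡ 1
  τ-exp-τ = trans (toℕ-mod 1) (m<n⇒m%n≡m 1<p)

  twist≈1⇒τ-exp≡0 : ∀ g → twist g ≈ 1ℤ → τ-exp g ≡ 0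
  twist≈1⇒τ-exp≡0 g = ρ^≈1⇒≡0 (τ-exp<p g)

  exps≈0⇒≡one : ∀ {g} → τ-exp g ≡ 0 → α-exp g ≈ 0ℤ → g ≡ one
  exps≈0⇒≡one τg≡0 αg≈0 = ≡-from-exps (P.≈-reflexive (cong +_ (trans τg≡0 (sym τ-exp-one))))
                               (≈-trans αg≈0 (≈-reflexive (sym α-exp-one)))

  ·-assoc : ∀ g h k → (g · h) · k ≡ g · (h · k)
  ·-assoc g h k = ≡-from-exps τ-assoc α-assoc
    where
    τ-assoc : + τ-exp ((g · h) · k) P.≈ + τ-exp (g · (h · k))
    τ-assoc = begin
      + τ-exp ((g · h) · k)                    ≈⟨ τ-exp-· (g · h) k ⟩
      + τ-exp (g · h) + + τ-exp k              ≈⟨ P.+-congʳ (+ τ-exp k) (τ-exp-· g h) ⟩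
      + τ-exp g + + τ-exp h + + τ-exp k        ≡⟨ ℤP.+-assoc (+ τ-exp g) (+ τ-exp h) (+ τ-exp k) ⟩
      + τ-exp g + (+ τ-exp h + + τ-exp k)      ≈⟨ P.+-congˡ (+ τ-exp g) (τ-exp-· h k) ⟨
      + τ-exp g + + τ-exp (h · k)              ≈⟨ τ-exp-· g (h · k) ⟨
      + τ-exp (g · (h · k))                    ∎
      where open P.≈-Reasoning
    α-assoc : α-exp ((g · h) · k) ≈ α-exp (g · (h · k))
    α-assoc = begin
      α-exp ((g · h) · k)
        ≈⟨ α-exp-· (g · h) k ⟩
      α-exp (g · h) * twist k + α-exp k
        ≈⟨ +-congʳ (α-exp k) (*-congʳ (twist k) (α-exp-· g h)) ⟩
      (α-exp g * twist h + α-exp h) * twist k + α-exp k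
        ≡⟨ regroup (α-exp g) (α-exp h) (α-exp k) (twist h) (twist k) ⟩
      α-exp g * (twist h * twist k) + (α-exp h * twist k + α-exp k)
        ≈⟨ +-cong (*-congˡ (α-exp g) (twist-· h k)) (α-exp-· h k) ⟨
      α-exp g * twist (h · k) + α-exp (h · k)
        ≈⟨ α-exp-· g (h · k) ⟨
      α-exp (g · (h · k))
        ∎
      where
      open ≈-Reasoning
      regroup : ∀ a b c u v → (a * u + b) * v + c ≡ a * (u * v) + (b * v + c)
      regroup = solve-∀

  ·-identityʳ : ∀ g → g · one ≡ g
  ·-identityʳ g = ≡-from-exps
    (P.≈-trans (τ-exp-· g one)
       (P.≈-reflexive (cong +_ (trans (cong (τ-exp g ℕ.+_) τ-exp-one) (ℕP.+-identityʳ (τ-exp g))))))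
    (≈-trans (α-exp-· g one) (≈-reflexive (begin
      α-exp g * twist one + α-exp one     ≡⟨ cong₂ (λ t a → α-exp g * ρ ^ℤ t + a) τ-exp-one α-exp-one ⟩
      α-exp g * 1ℤ + 0ℤ                   ≡⟨ ℤP.+-identityʳ (α-exp g * 1ℤ) ⟩
      α-exp g * 1ℤ                        ≡⟨ ℤP.*-identityʳ (α-exp g) ⟩
      α-exp g                             ∎)))
    where open ≡-Reasoning

  ·-identityˡ : ∀ g → one · g ≡ g
  ·-identityˡ g = ≡-from-exps
    (P.≈-trans (τ-exp-· one g) (P.≈-reflexive (cong (λ t → + (t ℕ.+ τ-exp g)) τ-exp-one)))
    (≈-trans (α-exp-· one g) (≈-reflexive (begin
      α-exp one * twist g + α-exp g       ≡⟨ cong (λ a → a * twist g + α-exp g) α-exp-one ⟩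
      0ℤ * twist g + α-exp g              ≡⟨ ℤP.+-identityˡ (α-exp g) ⟩
      α-exp g                             ∎)))
    where open ≡-Reasoning

  ·-cancelˡ : ∀ g {h k} → g · h ≡ g · k → h ≡ k
  ·-cancelˡ g {h} {k} gh≡gk = ≡-from-exps τ≈ α≈
    where
    τ≈ : + τ-exp h P.≈ + τ-exp k
    τ≈ = P.+-cancelˡ (+ τ-exp g) (P.≈-trans (P.≈-sym (τ-exp-· g h))
           (P.≈-trans (P.≈-reflexive (cong (+_ ∘ τ-exp) gh≡gk)) (τ-exp-· g k)))
    α≈ : α-exp h ≈ α-exp k
    α≈ = +-cancelˡ (α-exp g * twist h) (begin
      α-exp g * twist h + α-exp h    ≈⟨ α-exp-· g h ⟨
      α-exp (g · h)                  ≡⟨ cong α-exp gh≡gk ⟩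
      α-exp (g · k)                  ≈⟨ α-exp-· g k ⟩
      α-exp g * twist k + α-exp k    ≈⟨ +-congʳ (α-exp k) (*-congˡ (α-exp g) (ρ^-cong τ≈)) ⟨
      α-exp g * twist h + α-exp k    ∎)
      where open ≈-Reasoning

  conjugate⇒τ-exp≡ : ∀ {g h x} → g · x ≡ x · h → τ-exp g ≡ τ-exp h
  conjugate⇒τ-exp≡ {g} {h} {x} gx≡xh = P.+≈+⇒≡ (τ-exp<p g) (τ-exp<p h) (P.+-cancelˡ (+ τ-exp x) (begin
    + τ-exp x + + τ-exp g     ≡⟨ ℤP.+-comm (+ τ-exp x) (+ τ-exp g) ⟩
    + τ-exp g + + τ-exp x     ≈⟨ τ-exp-· g x ⟨
    + τ-exp (g · x)           ≡⟨ cong (+_ ∘ τ-exp) gx≡xh ⟩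
    + τ-exp (x · h)           ≈⟨ τ-exp-· x h ⟩
    + τ-exp x + + τ-exp h     ∎))
    where open P.≈-Reasoning

  -- Commuting elements

  _≟_ : DecidableEquality G
  _≟_ = ≡-dec FP._≟_ FP._≟_

  open import Data.List.Membership.DecPropositional _≟_ using (_∈?_)

  Commute : G → G → Set
  Commute g h = g · h ≡ h · g

  commute? : ∀ g h → Dec (Commute g h)
  commute? g h = (g · h) ≟ (h · g)

  Central : G → Set
  Central z = ∀ g → Commute z g

  private
    commutator-identity : ∀ a b u v → (a * u + b) - (b * v + a) ≡ a * (u - 1ℤ) - b * (v - 1ℤ)
    commutator-identity = solve-∀

  commute⇒exps : ∀ {g h} → Commute g h → α-exp g * (twist h - 1ℤ) ≈ α-exp h * (twist g - 1ℤ)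
  commute⇒exps {g} {h} gh≡hg = ≈-resp-difference (begin
    α-exp g * twist h + α-exp h    ≈⟨ α-exp-· g h ⟨
    α-exp (g · h)                  ≡⟨ cong α-exp gh≡hg ⟩
    α-exp (h · g)                  ≈⟨ α-exp-· h g ⟩
    α-exp h * twist g + α-exp g    ∎)
    (commutator-identity (α-exp g) (α-exp h) (twist h) (twist g))
    where open ≈-Reasoning

  exps⇒commute : ∀ {g h} → α-exp g * (twist h - 1ℤ) ≈ α-exp h * (twist g - 1ℤ) → Commute g h
  exps⇒commute {g} {h} exps = ≡-from-exps τ≈ α≈
    where
    τ≈ : + τ-exp (g · h) P.≈ + τ-exp (h · g)
    τ≈ = P.≈-trans (τ-exp-· g h)
           (P.≈-trans (P.≈-reflexive (ℤP.+-comm (+ τ-exp g) (+ τ-exp h))) (P.≈-sym (τ-exp-· h g)))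
    α≈ : α-exp (g · h) ≈ α-exp (h · g)
    α≈ = begin
      α-exp (g · h)                  ≈⟨ α-exp-· g h ⟩
      α-exp g * twist h + α-exp h    ≈⟨ ≈-resp-difference exps
                                          (sym (commutator-identity (α-exp g) (α-exp h) (twist h) (twist g))) ⟩
      α-exp h * twist g + α-exp g    ≈⟨ α-exp-· h g ⟨
      α-exp (h · g)                  ∎
      where open ≈-Reasoning

  commute-· : ∀ {z x y} → Commute z x → Commute z y → Commute z (x · y)
  commute-· {z} {x} {y} zx≡xz zy≡yz = begin
    z · (x · y)    ≡⟨ ·-assoc z x y ⟨
    (z · x) · y    ≡⟨ cong (_· y) zx≡xz ⟩
    (x · z) · y    ≡⟨ ·-assoc x z y ⟩
    x · (z · y)    ≡⟨ cong (x ·_) zy≡yz ⟩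
    x · (y · z)    ≡⟨ ·-assoc x y z ⟨
    (x · y) · z    ∎
    where open ≡-Reasoning

  commute-inverse : ∀ {z x y} → Commute z x → x · y ≡ one → Commute z y
  commute-inverse {z} {x} {y} zx≡xz xy≡1 = ·-cancelˡ x (begin
    x · (z · y)    ≡⟨ ·-assoc x z y ⟨
    (x · z) · y    ≡⟨ cong (_· y) zx≡xz ⟨
    (z · x) · y    ≡⟨ ·-assoc z x y ⟩
    z · (x · y)    ≡⟨ cong (z ·_) xy≡1 ⟩
    z · one        ≡⟨ ·-identityʳ z ⟩
    z              ≡⟨ ·-identityˡ z ⟨
    one · z        ≡⟨ cong (_· z) xy≡1 ⟨
    (x · y) · z    ≡⟨ ·-assoc x y z ⟩
    x · (y · z)    ∎)
    where open ≡-Reasoning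

  generators-commute⇒central : ∀ {S z} → (∀ g → Generated S g) → All (Commute z) S → Central z
  generators-commute⇒central {S} {z} generates z-commutes g = centralizes (generates g)
    where
    centralizes : ∀ {g} → Generated S g → Commute z g
    centralizes (gen-elem g∈S)             = All.lookup z-commutes g∈S
    centralizes gen-one                    = trans (·-identityʳ z) (sym (·-identityˡ z))
    centralizes (gen-mul {x} {y} gₓ gᵧ)   = commute-· {z} {x} {y} (centralizes gₓ) (centralizes gᵧ)
    centralizes (gen-inv {x} {y} gₓ xy≡1) = commute-inverse {z} {x} {y} (centralizes gₓ) xy≡1

  noncentral⇒noncommuting-generator : ∀ {S z} → (∀ g → Generated S g) → ¬ Central z →
                                      Σ[ y ∈ G ] (y ∈ S × ¬ Commute z y)
  noncentral⇒noncommuting-generator {S} {z} generates noncentral with all? (commute? z) S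
  ... | yes z-commutes = contradiction (generators-commute⇒central generates z-commutes) noncentral
  ... | no  ¬z-commutes = find (AllP.¬All⇒Any¬ (commute? z) S ¬z-commutes)

  commute-α⇒τ-exp≡0 : ∀ {g} → Commute g α → τ-exp g ≡ 0
  commute-α⇒τ-exp≡0 {g} gα≡αg = twist≈1⇒τ-exp≡0 g (-≈0⇒≈ (begin
    twist g - 1ℤ                  ≡⟨ ℤP.*-identityˡ (twist g - 1ℤ) ⟨
    1ℤ * (twist g - 1ℤ)           ≡⟨ cong (_* (twist g - 1ℤ)) α-exp-α ⟨
    α-exp α * (twist g - 1ℤ)      ≈⟨ commute⇒exps {g} {α} gα≡αg ⟨
    α-exp g * (twist α - 1ℤ)      ≡⟨ cong (λ t → α-exp g * (ρ ^ℤ t - 1ℤ)) τ-exp-α ⟩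
    α-exp g * 0ℤ                  ≡⟨ ℤP.*-zeroʳ (α-exp g) ⟩
    0ℤ                            ∎))
    where open ≈-Reasoning

  τ-exp≡0⇒commute-α : ∀ {g} → τ-exp g ≡ 0 → Commute α g
  τ-exp≡0⇒commute-α {g} τg≡0 = exps⇒commute {α} {g} (≈-reflexive (begin
    α-exp α * (twist g - 1ℤ)      ≡⟨ cong (λ t → α-exp α * (ρ ^ℤ t - 1ℤ)) τg≡0 ⟩
    α-exp α * 0ℤ                  ≡⟨ ℤP.*-zeroʳ (α-exp α) ⟩
    0ℤ                            ≡⟨ ℤP.*-zeroʳ (α-exp g) ⟨
    α-exp g * 0ℤ                  ≡⟨ cong (λ t → α-exp g * (ρ ^ℤ t - 1ℤ)) τ-exp-α ⟨
    α-exp g * (twist α - 1ℤ)      ∎))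
    where open ≡-Reasoning

  α-noncentral : ¬ Central α
  α-noncentral central = ℕP.1+n≢0 (trans (sym τ-exp-τ) (commute-α⇒τ-exp≡0 (sym (central τ))))

  outside-⟨α⟩⇒noncentral : ∀ {z} → τ-exp z ≢ 0 → ¬ Central z
  outside-⟨α⟩⇒noncentral τz≢0 central = τz≢0 (commute-α⇒τ-exp≡0 (central α))

  commute-with-⟨α⟩ : ∀ {a x} → τ-exp x ≡ 0 → Commute a x → x ≡ one ⊎ τ-exp a ≡ 0
  commute-with-⟨α⟩ {a} {x} τx≡0 ax≡xa =
    Sum.map (exps≈0⇒≡one τx≡0) (twist≈1⇒τ-exp≡0 a ∘ -≈0⇒≈) (*≈0⇒ q-prime (begin
      α-exp x * (twist a - 1ℤ)    ≈⟨ commute⇒exps {a} {x} ax≡xa ⟨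
      α-exp a * (twist x - 1ℤ)    ≡⟨ cong (λ t → α-exp a * (ρ ^ℤ t - 1ℤ)) τx≡0 ⟩
      α-exp a * 0ℤ                ≡⟨ ℤP.*-zeroʳ (α-exp a) ⟩
      0ℤ                          ∎))
    where open ≈-Reasoning

  commuting-pair⇒τ-exp≡0 : ∀ {a b x} → τ-exp a ≡ τ-exp b → a ≢ b → Commute a x → Commute b x → τ-exp x ≡ 0
  commuting-pair⇒τ-exp≡0 {a} {b} {x} τa≡τb a≢b ax≡xa bx≡xb =
    [ contradiction′ , twist≈1⇒τ-exp≡0 x ∘ -≈0⇒≈ ]′ (*≈0⇒ q-prime (begin
      (α-exp a - α-exp b) * (twist x - 1ℤ)
        ≡⟨ distrib (α-exp a) (α-exp b) (twist x - 1ℤ) ⟩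
      α-exp a * (twist x - 1ℤ) - α-exp b * (twist x - 1ℤ)
        ≈⟨ -cong (commute⇒exps {a} {x} ax≡xa) (commute⇒exps {b} {x} bx≡xb) ⟩
      α-exp x * (twist a - 1ℤ) - α-exp x * (twist b - 1ℤ)
        ≡⟨ cong (λ t → α-exp x * (twist a - 1ℤ) - α-exp x * (ρ ^ℤ t - 1ℤ)) τa≡τb ⟨
      α-exp x * (twist a - 1ℤ) - α-exp x * (twist a - 1ℤ)
        ≡⟨ ℤP.+-inverseʳ (α-exp x * (twist a - 1ℤ)) ⟩
      0ℤ
        ∎))
    where
    open ≈-Reasoning
    distrib : ∀ a b t → (a - b) * t ≡ a * t - b * t
    distrib = solve-∀
    contradiction′ : α-exp a - α-exp b ≈ 0ℤ → τ-exp x ≡ 0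
    contradiction′ αa-αb≈0 =
      contradiction (≡-from-exps (P.≈-reflexive (cong +_ τa≡τb)) (-≈0⇒≈ αa-αb≈0)) a≢b

  at-most-one-commutes : ∀ {x a b T} → x ≢ one → (τ-exp x ≢ 0 ⊎ ¬ + T P.≈ 0ℤ) →
                         + τ-exp a P.≈ + T → + τ-exp b P.≈ + T → a ≢ b → Commute a x → ¬ Commute b x
  at-most-one-commutes {x} {a} {b} x≢1 outside a∈T b∈T a≢b ax≡xa bx≡xb =
    [ x≢1 , τa≢0 ]′ (commute-with-⟨α⟩ τx≡0 ax≡xa)
    where
    τx≡0 : τ-exp x ≡ 0
    τx≡0 = commuting-pair⇒τ-exp≡0 τa≡τb a≢b ax≡xa bx≡xb
      where τa≡τb = P.+≈+⇒≡ (τ-exp<p a) (τ-exp<p b) (P.≈-trans a∈T (P.≈-sym b∈T))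
    τa≢0 : τ-exp a ≢ 0
    τa≢0 τa≡0 = [ (λ τx≢0 → τx≢0 τx≡0)
                , (λ T≉0 → T≉0 (P.≈-trans (P.≈-sym a∈T) (P.≈-reflexive (cong +_ τa≡0)))) ]′ outside

  -- Growing sets of products

  conjugation-closed⇒p≤length : ∀ {x a₀} (A : List G) →
    (∀ {a} → a ∈ A → Σ[ a′ ∈ G ] (a′ ∈ A × a · x ≡ x · a′)) → a₀ ∈ A → ¬ Commute a₀ x → p ≤ length A
  conjugation-closed⇒p≤length {x} {a₀} A closed a₀∈A a₀x≢xa₀ =
    distinct-values⇒≤length p A o (proj₂ ∘ orbit) distinct
    where
    -- orbit k is x⁻ᵏ a₀ xᵏ, which stays in A.
    orbit : ℕ → Σ[ a ∈ G ] a ∈ A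
    orbit zero    = a₀ , a₀∈A
    orbit (suc k) = proj₁ (closed (proj₂ (orbit k))) , proj₁ (proj₂ (closed (proj₂ (orbit k))))

    o : ℕ → G
    o = proj₁ ∘ orbit

    o-step : ∀ k → o k · x ≡ x · o (suc k)
    o-step k = proj₂ (proj₂ (closed (proj₂ (orbit k))))

    τ-o : ∀ k → τ-exp (o k) ≡ τ-exp a₀
    τ-o zero    = refl
    τ-o (suc k) = trans (sym (conjugate⇒τ-exp≡ {o k} {o (suc k)} {x} (o-step k))) (τ-o k)

    c : ℕ → ℤ
    c = α-exp ∘ o

    c-step : ∀ k → c (suc k) ≈ twist x * c k + (α-exp x - α-exp x * twist a₀)
    c-step k = ≈-resp-difference (begin
      α-exp x * twist a₀ + c (suc k)            ≡⟨ cong (λ t → α-exp x * ρ ^ℤ t + c (suc k)) (τ-o (suc k)) ⟨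
      α-exp x * twist (o (suc k)) + c (suc k)   ≈⟨ α-exp-· x (o (suc k)) ⟨
      α-exp (x · o (suc k))                     ≡⟨ cong α-exp (o-step k) ⟨
      α-exp (o k · x)                           ≈⟨ α-exp-· (o k) x ⟩
      c k * twist x + α-exp x                   ∎)
      (rearrange (α-exp x) (twist a₀) (c (suc k)) (c k) (twist x))
      where
      open ≈-Reasoning
      rearrange : ∀ a t c′ c u → (a * t + c′) - (c * u + a) ≡ c′ - (u * c + (a - a * t))
      rearrange = solve-∀

    c₁-c₀≉0 : ¬ c 1 - c 0 ≈ 0ℤ
    c₁-c₀≉0 c₁-c₀≈0 = a₀x≢xa₀ (subst (λ a → a₀ · x ≡ x · a) o₁≡a₀ (o-step 0))
      where
      o₁≡a₀ : o 1 ≡ a₀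
      o₁≡a₀ = ≡-from-exps (P.≈-reflexive (cong +_ (τ-o 1))) (-≈0⇒≈ c₁-c₀≈0)

    -- o i ≡ o j would make ρ^(s i) · geom (ρ^s) (j ∸ i) · (c 1 - c 0) vanish modulo q, where
    -- s = τ-exp x, yet none of the three factors does.
    distinct : ∀ {i j} → i < j → j < p → o i ≢ o j
    distinct {i} {j} i<j j<p oᵢ≡oⱼ =
      [ [ ^≉0 q-prime (^≉0 q-prime ρ≉0 (τ-exp x)) i
        , geom-ρ^≉0 (τ-exp<p x) (ℕP.m<n⇒0<n∸m i<j) (ℕP.≤-<-trans (ℕP.m∸n≤m j i) j<p) ]′ ∘ *≈0⇒ q-prime
      , c₁-c₀≉0 ]′ (*≈0⇒ q-prime (begin
        twist x ^ℤ i * geom (twist x) (j ∸ i) * (c 1 - c 0)   ≈⟨ affine-orbit c c-step i (j ∸ i) ⟨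
        c (i ℕ.+ (j ∸ i)) - c i                               ≡⟨ cong (λ n → c n - c i) (ℕP.m+[n∸m]≡n (ℕP.<⇒≤ i<j)) ⟩
        c j - c i                                             ≡⟨ cong (λ g → α-exp g - c i) oᵢ≡oⱼ ⟨
        c i - c i                                             ≡⟨ ℤP.+-inverseʳ (c i) ⟩
        0ℤ                                                    ∎))
      where open ≈-Reasoning

  prod-∷ʳ : ∀ xs x → prod (xs ∷ʳ x) ≡ prod xs · x
  prod-∷ʳ []       x = trans (·-identityʳ x) (sym (·-identityˡ x))
  prod-∷ʳ (y ∷ xs) x = trans (cong (y ·_) (prod-∷ʳ xs x)) (sym (·-assoc y (prod xs) x))

  π-·ˡ : ∀ {D g} x → π D g → π (x ∷ D) (x · g)
  π-·ˡ x (T , T↭D , ∏T≡g) = x ∷ T , prep x T↭D , cong (x ·_) ∏T≡g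

  π-·ʳ : ∀ {D g} x → π D g → π (x ∷ D) (g · x)
  π-·ʳ x (T , T↭D , ∏T≡g) =
    T ∷ʳ x , ↭-trans (↭-sym (PermP.∷↭∷ʳ x T)) (prep x T↭D) , trans (prod-∷ʳ T x) (cong (_· x) ∏T≡g)

  π-resp-↭ : ∀ {D D′ g} → D ↭ D′ → π D g → π D′ g
  π-resp-↭ D↭D′ (T , T↭D , ∏T≡g) = T , ↭-trans T↭D D↭D′ , ∏T≡g

  level : List G → ℕ
  level D = sum (map τ-exp D)

  record State (D : List G) : Set where
    field
      elements : List G
      unique   : Unique elements
      products : All (π D) elements
      in-coset : All (λ g → + τ-exp g P.≈ + level D) elements
      large    : p ⊓ length D ≤ length elements

  module _ {D : List G} (x : G) (st : State D) where
    open State st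

    private
      xA : List G
      xA = map (x ·_) elements

      xA-unique : Unique xA
      xA-unique = UniqueP.map⁺ (·-cancelˡ x) unique

      xA-products : All (π (x ∷ D)) xA
      xA-products = AllP.map⁺ (All.map (π-·ˡ x) products)

      xA-in-coset : All (λ g → + τ-exp g P.≈ + level (x ∷ D)) xA
      xA-in-coset = AllP.map⁺ (All.map (λ {g} g∈D → P.≈-trans (τ-exp-· x g) (P.+-congˡ (+ τ-exp x) g∈D))
                                       in-coset)

    extend : Σ[ a ∈ G ] (a ∈ elements × ¬ Commute a x) → State (x ∷ D)
    extend (a₀ , a₀∈A , a₀x≢xa₀) with all? (λ a → (a · x) ∈? xA) elements
    ... | yes closed = record
      { elements = xA
      ; unique   = xA-unique
      ; products = xA-products
      ; in-coset = xA-in-coset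
      ; large    = ℕP.≤-trans (ℕP.m⊓n≤m p _) (subst (p ≤_) (sym (LP.length-map (x ·_) elements))
                     (conjugation-closed⇒p≤length elements (∈-map⁻ (x ·_) ∘ All.lookup closed) a₀∈A a₀x≢xa₀))
      }
    ... | no ¬closed with a , a∈A , ax∉xA ← find (AllP.¬All⇒Any¬ (λ a → (a · x) ∈? xA) elements ¬closed) = record
      { elements = a · x ∷ xA
      ; unique   = AllP.¬Any⇒All¬ xA ax∉xA ∷ xA-unique
      ; products = π-·ʳ x (All.lookup products a∈A) ∷ xA-products
      ; in-coset = ax-in-coset ∷ xA-in-coset
      ; large    = ℕP.≤-trans (⊓-suc-≤ p (length D))
                     (s≤s (subst (p ⊓ length D ≤_) (sym (LP.length-map (x ·_) elements)) large))
      }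
      where
      ax-in-coset : + τ-exp (a · x) P.≈ + level (x ∷ D)
      ax-in-coset = begin
        + τ-exp (a · x)            ≈⟨ τ-exp-· a x ⟩
        + τ-exp a + + τ-exp x      ≈⟨ P.+-congʳ (+ τ-exp x) (All.lookup in-coset a∈A) ⟩
        + level D + + τ-exp x      ≡⟨ ℤP.+-comm (+ level D) (+ τ-exp x) ⟩
        + level (x ∷ D)            ∎
        where open P.≈-Reasoning

  noncommuting-element : ∀ {T x} A → Unique A → All (λ g → + τ-exp g P.≈ + T) A → 2 ≤ length A →
                         x ≢ one → (τ-exp x ≢ 0 ⊎ ¬ + T P.≈ 0ℤ) → Σ[ a ∈ G ] (a ∈ A × ¬ Commute a x)
  noncommuting-element {x = x} (a ∷ b ∷ _) ((a≢b ∷ _) ∷ _) (a∈T ∷ b∈T ∷ _) _ x≢1 outside with commute? a x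
  ... | no  ax≢xa = a , here refl , ax≢xa
  ... | yes ax≡xa = b , there (here refl) , at-most-one-commutes x≢1 outside a∈T b∈T a≢b ax≡xa
  noncommuting-element (_ ∷ []) _ _ (s≤s ()) _ _

  extend-admissible : ∀ {D} x → x ≢ one → (τ-exp x ≢ 0 ⊎ ¬ + level D P.≈ 0ℤ) → 2 ≤ length D →
                      State D → State (x ∷ D)
  extend-admissible x x≢1 outside 2≤∣D∣ st =
    extend x st (noncommuting-element elements unique in-coset 2≤∣A∣ x≢1 outside)
    where
    open State st
    2≤∣A∣ : 2 ≤ length elements
    2≤∣A∣ = ℕP.≤-trans (ℕP.⊓-glb 1<p 2≤∣D∣) large

  level-++-⟨α⟩ : ∀ R {D} → All (λ x → τ-exp x ≡ 0) R → level (R ++ D) ≡ level D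
  level-++-⟨α⟩ []      _              = refl
  level-++-⟨α⟩ (_ ∷ R) (τx≡0 ∷ τR≡0) = cong₂ ℕ._+_ τx≡0 (level-++-⟨α⟩ R τR≡0)

  extend-by-⟨α⟩ : ∀ {D} R → All (_≢ one) R → All (λ x → τ-exp x ≡ 0) R → ¬ + level D P.≈ 0ℤ →
                  2 ≤ length D → State D → State (R ++ D)
  extend-by-⟨α⟩ []      _             _             _       _     st = st
  extend-by-⟨α⟩ {D} (x ∷ R) (x≢1 ∷ R≢1) (τx≡0 ∷ τR≡0) D∉⟨α⟩ 2≤∣D∣ st =
    extend-admissible {R ++ D} x x≢1 (inj₂ (subst (λ n → ¬ + n P.≈ 0ℤ) (sym (level-++-⟨α⟩ R τR≡0)) D∉⟨α⟩))
      (ℕP.≤-trans 2≤∣D∣ (LP.length-++-≤ʳ D {R})) (extend-by-⟨α⟩ R R≢1 τR≡0 D∉⟨α⟩ 2≤∣D∣ st)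

  extend-outside-⟨α⟩ : ∀ {D} R → All (_≢ one) R → All (λ x → τ-exp x ≢ 0) R →
                       2 ≤ length D → State D → State (R ++ D)
  extend-outside-⟨α⟩ []      _             _             _     st = st
  extend-outside-⟨α⟩ {D} (x ∷ R) (x≢1 ∷ R≢1) (τx≢0 ∷ τR≢0) 2≤∣D∣ st =
    extend-admissible {R ++ D} x x≢1 (inj₁ τx≢0)
      (ℕP.≤-trans 2≤∣D∣ (LP.length-++-≤ʳ D {R})) (extend-outside-⟨α⟩ R R≢1 τR≢0 2≤∣D∣ st)

  singleton-state : ∀ x → State [ x ]
  singleton-state x = record
    { elements = [ x ]
    ; unique   = [] ∷ []
    ; products = ([ x ] , ↭-refl , ·-identityʳ x) ∷ []
    ; in-coset = P.≈-reflexive (cong +_ (sym (ℕP.+-identityʳ (τ-exp x)))) ∷ []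
    ; large    = ℕP.m⊓n≤n p 1
    }

  pair-state : ∀ x y → ¬ Commute x y → State (y ∷ x ∷ [])
  pair-state x y xy≢yx = extend y (singleton-state x) (x , here refl , xy≢yx)

  ManyProducts : List G → Set
  ManyProducts S = Σ[ L ∈ List G ] (Unique L × All (π S) L × p ⊓ length S ≤ length L)

  state⇒many-products : ∀ {S D} → S ↭ D → State D → ManyProducts S
  state⇒many-products S↭D st =
    elements , unique , All.map (π-resp-↭ (↭-sym S↭D)) products ,
    subst (λ n → p ⊓ n ≤ length elements) (sym (PermP.↭-length S↭D)) large
    where open State st

  generator-outside-⟨α⟩ : ∀ {S} → (∀ g → Generated S g) → Σ[ z ∈ G ] (z ∈ S × τ-exp z ≢ 0)
  generator-outside-⟨α⟩ {S} generates = proj₁ witness , proj₁ (proj₂ witness) , τy≢0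
    where
    witness : Σ[ y ∈ G ] (y ∈ S × ¬ Commute α y)
    witness = noncentral⇒noncommuting-generator {S} {α} generates α-noncentral
    τy≢0 : τ-exp (proj₁ witness) ≢ 0
    τy≢0 τy≡0 = proj₂ (proj₂ witness) (τ-exp≡0⇒commute-α {proj₁ witness} τy≡0)

  many-products-with-⟨α⟩-term : ∀ {S z w} → All (_≢ one) S → z ∈ S → τ-exp z ≢ 0 → w ∈ S → τ-exp w ≡ 0 →
                                ManyProducts S
  many-products-with-⟨α⟩-term {S} {z} {w} S≢1 z∈S τz≢0 w∈S τw≡0 = state⇒many-products S↭D
    (extend-outside-⟨α⟩ Ns Ns≢1 τNs≢0 (ℕP.≤-trans (s≤s (s≤s z≤n)) (LP.length-++-≤ʳ (z ∷ w ∷ []) {Zs}))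
      (extend-by-⟨α⟩ Zs Zs≢1 τZs≡0 zw∉⟨α⟩ (s≤s (s≤s z≤n)) (pair-state w z wz≢zw)))
    where
    z≢w : z ≢ w
    z≢w z≡w = τz≢0 (trans (cong τ-exp z≡w) τw≡0)

    S′ : List G
    S′ = proj₁ (∈-∈-≢⇒↭∷∷ z∈S w∈S z≢w)

    S↭z∷w∷S′ : S ↭ z ∷ w ∷ S′
    S↭z∷w∷S′ = proj₂ (∈-∈-≢⇒↭∷∷ z∈S w∈S z≢w)

    in-⟨α⟩? : ∀ g → Dec (τ-exp g ≡ 0)
    in-⟨α⟩? g = τ-exp g ℕ.≟ 0

    Zs Ns : List G
    Zs = proj₁ (partition in-⟨α⟩? S′)
    Ns = proj₂ (partition in-⟨α⟩? S′)

    S′↭Zs++Ns : S′ ↭ Zs ++ Ns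
    S′↭Zs++Ns = ↭ₛ⇒↭ (SetoidPermP.partition-↭ (≡.setoid G) in-⟨α⟩? S′)

    τZs≡0 : All (λ g → τ-exp g ≡ 0) Zs
    τZs≡0 = proj₁ (AllP.partition-All in-⟨α⟩? S′)

    τNs≢0 : All (λ g → τ-exp g ≢ 0) Ns
    τNs≢0 = proj₂ (AllP.partition-All in-⟨α⟩? S′)

    Zs++Ns≢1 : All (_≢ one) Zs × All (_≢ one) Ns
    Zs++Ns≢1 = AllP.++⁻ Zs (PermP.All-resp-↭ S′↭Zs++Ns (All-↭∷∷ S↭z∷w∷S′ S≢1))

    Zs≢1 : All (_≢ one) Zs
    Zs≢1 = proj₁ Zs++Ns≢1

    Ns≢1 : All (_≢ one) Ns
    Ns≢1 = proj₂ Zs++Ns≢1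

    wz≢zw : ¬ Commute w z
    wz≢zw wz≡zw = [ All.lookup S≢1 w∈S , τz≢0 ]′ (commute-with-⟨α⟩ {z} {w} τw≡0 (sym wz≡zw))

    zw∉⟨α⟩ : ¬ + level (z ∷ w ∷ []) P.≈ 0ℤ
    zw∉⟨α⟩ zw≈0 =
      τz≢0 (P.+≈+⇒≡ (τ-exp<p z) (ℕ.>-nonZero⁻¹ p) (P.≈-trans (P.≈-reflexive (cong +_ level≡τz)) zw≈0))
      where
      level≡τz : τ-exp z ≡ level (z ∷ w ∷ [])
      level≡τz = sym (trans (cong (λ t → τ-exp z ℕ.+ (t ℕ.+ 0)) τw≡0) (ℕP.+-identityʳ (τ-exp z)))

    S↭D : S ↭ Ns ++ Zs ++ z ∷ w ∷ []
    S↭D = begin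
      S                              ↭⟨ S↭z∷w∷S′ ⟩
      z ∷ w ∷ S′                     ↭⟨ prep z (prep w S′↭Zs++Ns) ⟩
      (z ∷ w ∷ []) ++ Zs ++ Ns       ↭⟨ PermP.++-comm (z ∷ w ∷ []) (Zs ++ Ns) ⟩
      (Zs ++ Ns) ++ z ∷ w ∷ []       ≡⟨ LP.++-assoc Zs Ns (z ∷ w ∷ []) ⟩
      Zs ++ Ns ++ z ∷ w ∷ []         ↭⟨ PermP.shifts Zs Ns ⟩
      Ns ++ Zs ++ z ∷ w ∷ []         ∎
      where open PermutationReasoning

  many-products-outside-⟨α⟩ : ∀ {S z} → All (_≢ one) S → All (λ g → τ-exp g ≢ 0) S →
                              (∀ g → Generated S g) → z ∈ S → ManyProducts S
  many-products-outside-⟨α⟩ {S} {z} S≢1 τS≢0 generates z∈S =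
    state⇒many-products (↭-trans S↭y∷z∷S′ (PermP.++-comm (y ∷ z ∷ []) S′))
      (extend-outside-⟨α⟩ S′ (All-↭∷∷ S↭y∷z∷S′ S≢1) (All-↭∷∷ S↭y∷z∷S′ τS≢0) (s≤s (s≤s z≤n))
        (pair-state z y zy≢yz))
    where
    partner : Σ[ y ∈ G ] (y ∈ S × ¬ Commute z y)
    partner = noncentral⇒noncommuting-generator {S} {z} generates
                (outside-⟨α⟩⇒noncentral {z} (All.lookup τS≢0 z∈S))
    y : G
    y = proj₁ partner
    zy≢yz : ¬ Commute z y
    zy≢yz = proj₂ (proj₂ partner)
    y≢z : y ≢ z
    y≢z y≡z = zy≢yz (subst (Commute z) (sym y≡z) refl)
    S′ : List G
    S′ = proj₁ (∈-∈-≢⇒↭∷∷ (proj₁ (proj₂ partner)) z∈S y≢z)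
    S↭y∷z∷S′ : S ↭ y ∷ z ∷ S′
    S↭y∷z∷S′ = proj₂ (∈-∈-≢⇒↭∷∷ (proj₁ (proj₂ partner)) z∈S y≢z)

  many-products : (S : List G) → All (_≢ one) S → (∀ g → Generated S g) → ManyProducts S
  many-products S S≢1 generates =
    from-generator (generator-outside-⟨α⟩ {S} generates) (any? (λ g → τ-exp g ℕ.≟ 0) S)
    where
    from-generator : Σ[ z ∈ G ] (z ∈ S × τ-exp z ≢ 0) → Dec (Any (λ g → τ-exp g ≡ 0) S) → ManyProducts S
    from-generator (z , z∈S , τz≢0) (yes some-in-⟨α⟩) =
      let w , w∈S , τw≡0 = find some-in-⟨α⟩ in many-products-with-⟨α⟩-term S≢1 z∈S τz≢0 w∈S τw≡0
    from-generator (z , z∈S , _)    (no none-in-⟨α⟩) =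
      many-products-outside-⟨α⟩ S≢1 (AllP.¬Any⇒All¬ S none-in-⟨α⟩) generates z∈S

lemma5p5 : (p q : ℕ) .{{_ : NonZero p}} .{{_ : NonZero q}} → Prime p → Prime q → p ∣ q ∸ 1 →
    (r : ℤ) → (+ q) ∣ℤ ((r ^ℤ p) - 1ℤ) → ¬ ((+ q) ∣ℤ (r - 1ℤ)) →
    let open Metacyclic p q r in
    (S : List G) → All (λ g → g ≢ one) S → (∀ g → Generated S g) →
    Σ[ L ∈ List G ] (Unique L × All (π S) L × p ⊓ length S ≤ length L)
lemma5p5 p q p-prime q-prime p∣q-1 r q∣r^p-1 q∤r-1 =
  MetacyclicProperties.many-products p q r p-prime q-prime p∣q-1 q∣r^p-1 q∤r-1
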